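{- Let $t$ be a $\lambda$-term and let $\vec{x} = (x_1, \dots, x_k)$ be a list of pairwise distinct variables with $\mathrm{Fv}(t) \subseteq \{x_1,\dots,x_k\}$. The following are equivalent: (1) $t$ is $\rhd\mathsf{shuf}$-normalizable; (2) $t \simeq_{\mathsf{shuf}} u$ for some $\rhd\mathsf{shuf}$-normal term $u$; (3) $[\![t]\!]_{\vec{x}} \neq \emptyset$; (4) there exists a derivation of $x_1 \colon P_1, \dots, x_k \colon P_k \vdash t \colon Q$ for some positive types $P_1, \dots, P_k, Q$; (5) $t$ is strongly $\rhd\mathsf{shuf}$-normalizable.
   Context: Terms: $t,u,s ::= x \mid \lambda x.t \mid tu$ (up to $\alpha$-conversion); values $v ::= x \mid \lambda x.t$. $\mathrm{Fv}(t)$ is the set of free variables, $t\{v/x\}$ capture-avoiding substitution. Root steps: ($\beta_v$) $(\lambda x.t)v \mapsto t\{v/x\}$ with $v$ a value; ($\sigma_1$) $(\lambda x.t)us \mapsto (\lambda x.ts)u$ if $x \notin \mathrm{Fv}(s)$; ($\sigma_3$) $v((\lambda x.s)u) \mapsto (\lambda x.vs)u$ if $v$ is a value and $x \notin \mathrm{Fv}(v)$. Balanced contexts: $B ::= [\cdot] \mid (\lambda x.B)t \mid Bt \mid tB$. For a root step $r$, the $\rhd r$-reduction is its closure under balanced contexts and the $r$-reduction is its closure under arbitrary contexts (also under $\lambda$). The $\rhd\mathsf{shuf}$-reduction is the union of $\rhd\beta_v$, $\rhd\sigma_1$, $\rhd\sigma_3$-reductions; $\mathsf{shuf}$-reduction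 is the union of $\beta_v$, $\sigma_1$, $\sigma_3$-reductions, and $\simeq_{\mathsf{shuf}}$ is its reflexive-symmetric-transitive closure. A term is $\rhd\mathsf{shuf}$-normal if no $\rhd\mathsf{shuf}$-step applies to it, $\rhd\mathsf{shuf}$-normalizable if it reduces in finitely many steps to a $\rhd\mathsf{shuf}$-normal term, strongly normalizable if there is no infinite reduction sequence from it. Types: positive types are finite multisets $[(P_1,Q_1),\dots,(P_n,Q_n)]$ ($n\ge 0$) of pairs of positive types; $\mathbf{0}$ denotes the empty multiset and $\uplus$ multiset union. An environment $\Gamma$ maps variables to positive types, with $\mathrm{Dom}(\Gamma)=\{x : \Gamma(x)\neq\mathbf{0}\}$ finite; $\Gamma \uplus \Delta$ is pointwise union; $\Gamma, x\colon P$ requires $x \notin \mathrm{Dom}(\Gamma)$; unlisted variables have type $\mathbf{0}$. Typing rules: (ax) $x\colon P \vdash x \colon P$; ($\lambda$) from $\Gamma_i, x\colon P_i \vdash t \colon Q_i$ for $1\le i\le n$ ($n \geq 0$) infer $\biguplus_i \Gamma_i \vdash \lambda x.t \colon [(P_1,Q_1),\dots,(P_n,Q_n)]$; ($@$) from $\Gamma \vdash t \colon [(P,Q)]$ and $\Delta \vdash u \colon P$ infer $\Gamma\uplus\Delta \vdash tu \colon Q$. For a list $\vec{x}=(x_1,\dots,x_k)$ of pairwise distinct variables containing $\mathrm{Fv}(t)$, the relational semantics is $[\![t]\!]_{\vec{x}} = \{((P_1,\dots,P_k),Q) \mid x_1\colon P_1,\dots,x_k\colon P_k \vdash t \colon Q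 \text{ is derivable}\}$. -}

module Defs where

open import Data.Nat using (ℕ; zero; suc)
open import Data.Nat.Properties using (_≟_)
open import Data.List using (List; []; _∷_; _++_)
open import Data.Vec using (Vec; []; _∷_; lookup)
open import Data.Vec.Membership.Propositional using () renaming (_∈_ to _∈ᵥ_)
open import Data.Fin using (Fin)
open import Data.Product using (_×_; _,_; Σ; ∃)
open import Data.Sum using (_⊎_)
open import Data.Empty using (⊥)
open import Relation.Nullary using (¬_; yes; no)
open import Relation.Binary.PropositionalEquality using (_≡_)
open import Relation.Binary.Construct.Closure.ReflexiveTransitive using (Star)
open import Relation.Binary.Construct.Closure.Equivalence using (EqClosure)
open import Induction.WellFounded using (Acc)

-- λ-terms, in de Bruijn notation (this realises "terms up to α-conversion").
-- Free variables are the natural numbers; a free index n of a subterm under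
-- m binders is written  var (m + n).

infixl 7 _·_
data Term : Set where
  var : ℕ → Term
  ƛ   : Term → Term
  _·_ : Term → Term → Term

data Value : Term → Set where
  var : ∀ n → Value (var n)
  ƛ   : ∀ t → Value (ƛ t)

data _∈Fv_ : ℕ → Term → Set where
  var  : ∀ {n} → n ∈Fv var n
  ƛ    : ∀ {n t} → suc n ∈Fv t → n ∈Fv ƛ t
  appˡ : ∀ {n t u} → n ∈Fv t → n ∈Fv (t · u)
  appʳ : ∀ {n t u} → n ∈Fv u → n ∈Fv (t · u)

ext : (ℕ → ℕ) → ℕ → ℕ
ext ρ zero    = zero
ext ρ (suc n) = suc (ρ n)

rename : (ℕ → ℕ) → Term → Term
rename ρ (var n) = var (ρ n)
rename ρ (ƛ t)   = ƛ (rename (ext ρ) t)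
rename ρ (t · u) = rename ρ t · rename ρ u

-- weakening: makes room for a new binder (the new bound variable does not
-- occur free in  shift t ; this realises the side conditions x ∉ Fv(−))
shift : Term → Term
shift = rename suc

exts : (ℕ → Term) → ℕ → Term
exts σ zero    = var zero
exts σ (suc n) = shift (σ n)

sub : (ℕ → Term) → Term → Term
sub σ (var n) = σ n
sub σ (ƛ t)   = ƛ (sub (exts σ) t)
sub σ (t · u) = sub σ t · sub σ u

-- t{v/x} where x is the bound variable (index 0) of  λx.t
single : Term → ℕ → Term
single v zero    = v
single v (suc n) = var n

_[_] : Term → Term → Term
t [ v ] = sub (single v) t

data _↦shuf_ : Term → Term → Set where
  βv : ∀ {t v} → Value v → (ƛ t · v) ↦shuf (t [ v ])
  σ₁ : ∀ {t u s} → ((ƛ t · u) · s) ↦shuf (ƛ (t · shift s) · u)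
  σ₃ : ∀ {v s u} → Value v → (v · (ƛ s · u)) ↦shuf (ƛ (shift v · s) · u)

-- closure under balanced contexts  B ::= [·] | (λx.B)t | Bt | tB
data _▷shuf_ : Term → Term → Set where
  root   : ∀ {t u} → t ↦shuf u → t ▷shuf u
  lamApp : ∀ {t t' s} → t ▷shuf t' → (ƛ t · s) ▷shuf (ƛ t' · s)
  appˡ   : ∀ {t t' s} → t ▷shuf t' → (t · s) ▷shuf (t' · s)
  appʳ   : ∀ {t s s'} → s ▷shuf s' → (t · s) ▷shuf (t · s')

data _→shuf_ : Term → Term → Set where
  root : ∀ {t u} → t ↦shuf u → t →shuf u
  lam  : ∀ {t t'} → t →shuf t' → ƛ t →shuf ƛ t'
  appˡ : ∀ {t t' s} → t →shuf t' → (t · s) →shuf (t' · s)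
  appʳ : ∀ {t s s'} → s →shuf s' → (t · s) →shuf (t · s')

_≃shuf_ : Term → Term → Set
_≃shuf_ = EqClosure _→shuf_

▷shuf-normal : Term → Set
▷shuf-normal t = ¬ (∃ λ u → t ▷shuf u)

▷shuf-normalizable : Term → Set
▷shuf-normalizable t = ∃ λ u → Star _▷shuf_ t u × ▷shuf-normal u

-- strong normalisation: accessibility for the converse of ▷shuf
-- (the standard constructive rendering of "no infinite ▷shuf-sequence")
_◁shuf_ : Term → Term → Set
u ◁shuf t = t ▷shuf u

▷shuf-SN : Term → Set
▷shuf-SN t = Acc _◁shuf_ t

-- positive types: finite multisets of pairs of positive types,
-- represented by lists and compared up to (nested) multiset equality ≈

data Pos : Set where
  mk : List (Pos × Pos) → Pos

𝟎 : Pos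
𝟎 = mk []

_⊎ᴾ_ : Pos → Pos → Pos
mk xs ⊎ᴾ mk ys = mk (xs ++ ys)

mutual
  data _≈_ : Pos → Pos → Set where
    mk : ∀ {xs ys} → xs ≈ᴸ ys → mk xs ≈ mk ys

  data _≈ᴸ_ : List (Pos × Pos) → List (Pos × Pos) → Set where
    []    : [] ≈ᴸ []
    _∷_   : ∀ {P P' Q Q' xs ys} → (P ≈ P') × (Q ≈ Q') → xs ≈ᴸ ys →
            ((P , Q) ∷ xs) ≈ᴸ ((P' , Q') ∷ ys)
    swap  : ∀ {a b xs} → (a ∷ b ∷ xs) ≈ᴸ (b ∷ a ∷ xs)
    trans : ∀ {xs ys zs} → xs ≈ᴸ ys → ys ≈ᴸ zs → xs ≈ᴸ zs

-- environments: variables ↦ positive types (unlisted variables have type 𝟎)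
Env : Set
Env = ℕ → Pos

𝟎ᴱ : Env
𝟎ᴱ _ = 𝟎

_⊎ᴱ_ : Env → Env → Env
(Γ ⊎ᴱ Δ) n = Γ n ⊎ᴾ Δ n

_≈ᴱ_ : Env → Env → Set
Γ ≈ᴱ Δ = ∀ n → Γ n ≈ Δ n

[_∶_] : ℕ → Pos → Env
[ x ∶ P ] n with n ≟ x
... | yes _ = P
... | no  _ = 𝟎

-- Γ, x : P  for the bound variable x = index 0 (freshness is automatic)
_,₀_ : Env → Pos → Env
(Γ ,₀ P) zero    = P
(Γ ,₀ P) (suc n) = Γ n

-- typing.  Judgements are on multisets, i.e. every conclusion may be
-- given by any representative (up to ≈ / ≈ᴱ) of the environment and type.

infix 4 _⊢_∶_ _⊢λ_∶_
mutual
  data _⊢_∶_ : Env → Term → Pos → Set where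
    ax  : ∀ {Γ x P Q} → Γ ≈ᴱ [ x ∶ P ] → Q ≈ P → Γ ⊢ var x ∶ Q
    lam : ∀ {Γ Δ t L R} → Δ ⊢λ t ∶ L → Γ ≈ᴱ Δ → R ≈ mk L → Γ ⊢ ƛ t ∶ R
    app : ∀ {Γ Δ Θ t u P Q R} → Γ ⊢ t ∶ mk ((P , Q) ∷ []) → Δ ⊢ u ∶ P →
          Θ ≈ᴱ (Γ ⊎ᴱ Δ) → R ≈ Q → Θ ⊢ t · u ∶ R

  -- the n ≥ 0 premises  Γᵢ, x : Pᵢ ⊢ t : Qᵢ  of rule (λ), with conclusion
  -- environment ⊎ᵢ Γᵢ and list of pairs (Pᵢ , Qᵢ)
  data _⊢λ_∶_ : Env → Term → List (Pos × Pos) → Set where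
    []  : ∀ {t} → 𝟎ᴱ ⊢λ t ∶ []
    _∷_ : ∀ {Γ Δ t P Q L} → (Γ ,₀ P) ⊢ t ∶ Q → Δ ⊢λ t ∶ L →
          (Γ ⊎ᴱ Δ) ⊢λ t ∶ ((P , Q) ∷ L)

Distinct : ∀ {k} → Vec ℕ k → Set
Distinct xs = ∀ i j → lookup xs i ≡ lookup xs j → i ≡ j

FvIn : ∀ {k} → Term → Vec ℕ k → Set
FvIn t xs = ∀ n → n ∈Fv t → n ∈ᵥ xs

envOf : ∀ {k} → Vec ℕ k → Vec Pos k → Env
envOf []       []       = 𝟎ᴱ
envOf (x ∷ xs) (P ∷ Ps) = [ x ∶ P ] ⊎ᴱ envOf xs Ps

⟦_⟧ : ∀ {k} → Term → Vec ℕ k → Vec Pos k × Pos → Set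
⟦ t ⟧ xs (Ps , Q) = envOf xs Ps ⊢ t ∶ Q

NonEmpty : ∀ {k} → (Vec Pos k × Pos → Set) → Set
NonEmpty S = ∃ λ p → S p

module Submission where

-- Typability is invariant under shuffling conversion: subject reduction and
-- subject expansion hold for βv, σ₁ and σ₃ in every context, the βv case
-- resting on the fact that a derivation typing a value at P ⊎ P' splits into
-- derivations at P and P' (and conversely merges).  Every ▷shuf-normal term is
-- typable, so normalizable and ≃shuf-normalizable terms are typable.  Conversely,
-- along a ▷shuf-step a derivation can be transported so that the pair
-- (size of the derivation, multiplicative weight of the term) decreases
-- lexicographically: βv strictly shrinks the derivation, while σ₁ and σ₃ keep
-- its size and decrease the weight.  Hence typable terms are strongly
-- normalising, and as having a ▷shuf-redex is decidable, they normalise.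
-- Finally, a derivation's environment vanishes outside Fv(t), so it has the
-- shape x₁ : P₁, …, xₖ : Pₖ.

open import Defs
open import Algebra.Bundles using (CommutativeMonoid)
import Algebra.Construct.Pointwise as Pointwise
import Algebra.Properties.CommutativeSemigroup as CommutativeSemigroupProperties
open import Algebra.Structures using (IsCommutativeMonoid)
open import Data.Empty using (⊥; ⊥-elim)
import Data.Fin as Fin
open import Data.List using ([]; _∷_; _++_)
open import Data.List.Properties using (++-assoc; ++-identityʳ)
open import Data.Nat using (ℕ; zero; suc; pred; _+_; _*_; _≤_; _<_; z≤n; s≤s; NonZero; >-nonZero)
open import Data.Nat.Induction using (<-wellFounded)
open import Data.Nat.Properties
  using (_≟_; suc-injective; 1+n≢0; +-identityʳ; +-assoc; ≤-refl; ≤-trans; ≤-reflexive; m≤n⇒m≤1+n;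
         +-mono-≤; +-monoʳ-≤; +-monoˡ-<; +-monoʳ-<; *-mono-≤; *-monoˡ-<; *-monoʳ-<; m<m*n;
         module ≤-Reasoning)
open import Data.Nat.Tactic.RingSolver using (solve-∀)
open import Data.Product using (_×_; ∃; ∃₂; _,_; proj₁; proj₂; Σ-syntax; map₂)
open import Data.Product.Relation.Binary.Lex.Strict using (×-Lex; ×-wellFounded)
open import Data.Sum using (_⊎_; inj₁; inj₂)
open import Data.Unit using (⊤; tt)
open import Data.Vec using (Vec; []; _∷_)
import Data.Vec as V
open import Data.Vec.Membership.Propositional using () renaming (_∈_ to _∈ᵥ_)
open import Data.Vec.Membership.DecPropositional _≟_ using (_∈?_)
open import Data.Vec.Relation.Unary.Any using (here; there; index)
open import Data.Vec.Relation.Unary.Any.Properties using (lookup-index)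
open import Function.Base using (_∘_)
open import Function.Bundles using (_⇔_; mk⇔)
open import Function.Definitions using (Injective)
open import Induction.WellFounded using (Acc; acc)
open import Level using (0ℓ)
open import Relation.Binary.Construct.Closure.ReflexiveTransitive using (Star; ε; _◅_)
open import Relation.Binary.Construct.Closure.Symmetric using (fwd; bwd)
open import Relation.Binary.PropositionalEquality as ≡
  using (_≡_; _≢_; refl; cong; cong₂; module ≡-Reasoning)
open import Relation.Nullary using (¬_; yes; no)

-- Positive types as multisets

mutual
  ≈-refl : ∀ {P} → P ≈ P
  ≈-refl {mk xs} = mk ≈ᴸ-refl

  ≈ᴸ-refl : ∀ {xs} → xs ≈ᴸ xs
  ≈ᴸ-refl {[]}    = []
  ≈ᴸ-refl {_ ∷ _} = (≈-refl , ≈-refl) ∷ ≈ᴸ-refl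

mutual
  ≈-sym : ∀ {P Q} → P ≈ Q → Q ≈ P
  ≈-sym (mk e) = mk (≈ᴸ-sym e)

  ≈ᴸ-sym : ∀ {xs ys} → xs ≈ᴸ ys → ys ≈ᴸ xs
  ≈ᴸ-sym []            = []
  ≈ᴸ-sym ((p , q) ∷ e) = (≈-sym p , ≈-sym q) ∷ ≈ᴸ-sym e
  ≈ᴸ-sym swap          = swap
  ≈ᴸ-sym (trans e f)   = trans (≈ᴸ-sym f) (≈ᴸ-sym e)

≈-trans : ∀ {P Q R} → P ≈ Q → Q ≈ R → P ≈ R
≈-trans (mk e) (mk f) = mk (trans e f)

∷-congʳ : ∀ a {xs ys} → xs ≈ᴸ ys → (a ∷ xs) ≈ᴸ (a ∷ ys)
∷-congʳ _ e = (≈-refl , ≈-refl) ∷ e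

++-congˡ : ∀ {xs xs'} ys → xs ≈ᴸ xs' → (xs ++ ys) ≈ᴸ (xs' ++ ys)
++-congˡ ys []          = ≈ᴸ-refl
++-congˡ ys (p ∷ e)     = p ∷ ++-congˡ ys e
++-congˡ ys swap        = swap
++-congˡ ys (trans e f) = trans (++-congˡ ys e) (++-congˡ ys f)

++-congʳ : ∀ xs {ys ys'} → ys ≈ᴸ ys' → (xs ++ ys) ≈ᴸ (xs ++ ys')
++-congʳ []       e = e
++-congʳ (a ∷ xs) e = ∷-congʳ a (++-congʳ xs e)

≈ᴸ-shift : ∀ a ys zs → (a ∷ ys ++ zs) ≈ᴸ (ys ++ a ∷ zs)
≈ᴸ-shift a []       zs = ≈ᴸ-refl
≈ᴸ-shift a (b ∷ ys) zs = trans swap (∷-congʳ b (≈ᴸ-shift a ys zs))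

≈ᴸ-++-comm : ∀ xs ys → (xs ++ ys) ≈ᴸ (ys ++ xs)
≈ᴸ-++-comm []       ys rewrite ++-identityʳ ys = ≈ᴸ-refl
≈ᴸ-++-comm (a ∷ xs) ys = trans (∷-congʳ a (≈ᴸ-++-comm xs ys)) (≈ᴸ-shift a ys xs)

≈ᴸ-[] : ∀ {xs} → xs ≈ᴸ [] → xs ≡ []
≈ᴸ-[] []          = refl
≈ᴸ-[] (trans e f) with ≈ᴸ-[] f
... | refl = ≈ᴸ-[] e

≈ᴸ-[-] : ∀ {xs P Q} → xs ≈ᴸ ((P , Q) ∷ []) →
         ∃₂ λ A B → xs ≡ (A , B) ∷ [] × A ≈ P × B ≈ Q
≈ᴸ-[-] ((p , q) ∷ e) with ≈ᴸ-[] e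
... | refl = _ , _ , refl , p , q
≈ᴸ-[-] (trans e f) with ≈ᴸ-[-] f
... | _ , _ , refl , p , q with ≈ᴸ-[-] e
... | _ , _ , refl , p' , q' = _ , _ , refl , ≈-trans p' p , ≈-trans q' q

≡⇒≈ : ∀ {P Q} → P ≡ Q → P ≈ Q
≡⇒≈ refl = ≈-refl

⊎ᴾ-cong : ∀ {P P' Q Q'} → P ≈ P' → Q ≈ Q' → (P ⊎ᴾ Q) ≈ (P' ⊎ᴾ Q')
⊎ᴾ-cong {mk xs} {mk xs'} {mk ys} (mk e) (mk f) = mk (trans (++-congˡ ys e) (++-congʳ xs' f))

⊎ᴾ-isCommutativeMonoid : IsCommutativeMonoid _≈_ _⊎ᴾ_ 𝟎
⊎ᴾ-isCommutativeMonoid = record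
  { isMonoid = record
    { isSemigroup = record
      { isMagma = record
        { isEquivalence = record { refl = ≈-refl ; sym = ≈-sym ; trans = ≈-trans }
        ; ∙-cong = ⊎ᴾ-cong
        }
      ; assoc = λ { (mk xs) (mk ys) (mk zs) → mk (≡⇒≈ᴸ (++-assoc xs ys zs)) }
      }
    ; identity = (λ { (mk xs) → ≈-refl }) , (λ { (mk xs) → mk (≡⇒≈ᴸ (++-identityʳ xs)) })
    }
  ; comm = λ { (mk xs) (mk ys) → mk (≈ᴸ-++-comm xs ys) }
  }
  where
  ≡⇒≈ᴸ : ∀ {xs ys} → xs ≡ ys → xs ≈ᴸ ys
  ≡⇒≈ᴸ refl = ≈ᴸ-refl

⊎ᴾ-commutativeMonoid : CommutativeMonoid 0ℓ 0ℓ
⊎ᴾ-commutativeMonoid = record { isCommutativeMonoid = ⊎ᴾ-isCommutativeMonoid }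

⊎ᴱ-commutativeMonoid : CommutativeMonoid 0ℓ 0ℓ
⊎ᴱ-commutativeMonoid = Pointwise.commutativeMonoid ℕ ⊎ᴾ-commutativeMonoid

open CommutativeMonoid ⊎ᴾ-commutativeMonoid using ()
  renaming (identityˡ to ⊎ᴾ-identityˡ; identityʳ to ⊎ᴾ-identityʳ)
open CommutativeMonoid ⊎ᴱ-commutativeMonoid using ()
  renaming (refl to ≈ᴱ-refl; sym to ≈ᴱ-sym; trans to ≈ᴱ-trans; ∙-cong to ⊎ᴱ-cong;
            assoc to ⊎ᴱ-assoc; identityˡ to ⊎ᴱ-identityˡ;
            identityʳ to ⊎ᴱ-identityʳ; commutativeSemigroup to ⊎ᴱ-commutativeSemigroup)
open CommutativeSemigroupProperties ⊎ᴱ-commutativeSemigroup using ()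
  renaming (interchange to ⊎ᴱ-interchange; xy∙z≈xz∙y to ⊎ᴱ-swapʳ; x∙yz≈y∙xz to ⊎ᴱ-swapˡ)


,₀-cong : ∀ {Γ Γ' P P'} → Γ ≈ᴱ Γ' → P ≈ P' → (Γ ,₀ P) ≈ᴱ (Γ' ,₀ P')
,₀-cong e p zero    = p
,₀-cong e p (suc n) = e n

,₀-η : ∀ Γ → Γ ≈ᴱ ((Γ ∘ suc) ,₀ Γ zero)
,₀-η Γ zero    = ≈-refl
,₀-η Γ (suc n) = ≈-refl

[∶]-≡ : ∀ x {P} → [ x ∶ P ] x ≡ P
[∶]-≡ x with x ≟ x
... | yes _ = refl
... | no x≢x = ⊥-elim (x≢x refl)

[∶]-≢ : ∀ {x n P} → n ≢ x → [ x ∶ P ] n ≡ 𝟎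
[∶]-≢ {x} {n} n≢x with n ≟ x
... | yes n≡x = ⊥-elim (n≢x n≡x)
... | no _    = refl

[∶]-inj : ∀ {ρ} → Injective _≡_ _≡_ ρ → ∀ x n {P} → [ ρ x ∶ P ] (ρ n) ≡ [ x ∶ P ] n
[∶]-inj {ρ} ρ-inj x n with n ≟ x
... | yes refl = [∶]-≡ (ρ x)
... | no n≢x   = [∶]-≢ (λ eq → n≢x (ρ-inj eq))

[∶]-cong : ∀ {x P P'} → P ≈ P' → [ x ∶ P ] ≈ᴱ [ x ∶ P' ]
[∶]-cong {x} p n with n ≟ x
... | yes _ = p
... | no _  = ≈-refl

[∶]-⊎ : ∀ x P Q → ([ x ∶ P ] ⊎ᴱ [ x ∶ Q ]) ≈ᴱ [ x ∶ P ⊎ᴾ Q ]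
[∶]-⊎ x P Q n with n ≟ x
... | yes _ = ≈-refl
... | no _  = ≈-refl

[∶𝟎] : ∀ x → [ x ∶ 𝟎 ] ≈ᴱ 𝟎ᴱ
[∶𝟎] x n with n ≟ x
... | yes _ = ≈-refl
... | no _  = ≈-refl

,₀-⊎ : ∀ Γ Δ P Q → ((Γ ,₀ P) ⊎ᴱ (Δ ,₀ Q)) ≈ᴱ ((Γ ⊎ᴱ Δ) ,₀ (P ⊎ᴾ Q))
,₀-⊎ Γ Δ P Q zero    = ≈-refl
,₀-⊎ Γ Δ P Q (suc n) = ≈-refl

,₀-𝟎 : (𝟎ᴱ ,₀ 𝟎) ≈ᴱ 𝟎ᴱ
,₀-𝟎 zero    = ≈-refl
,₀-𝟎 (suc n) = ≈-refl

-- punchIn (suc k) is ext (punchIn k) and insert𝟎 (suc k) (Γ ,₀ P) reduces to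
-- insert𝟎 k Γ ,₀ P, so weakening under a binder needs no transport.
punchIn : ℕ → ℕ → ℕ
punchIn zero    = suc
punchIn (suc k) = ext (punchIn k)

punchOut : ℕ → ℕ → ℕ
punchOut zero    x       = pred x
punchOut (suc k) zero    = zero
punchOut (suc k) (suc x) = suc (punchOut k x)

punchOut-punchIn : ∀ k m → punchOut k (punchIn k m) ≡ m
punchOut-punchIn zero    m       = refl
punchOut-punchIn (suc k) zero    = refl
punchOut-punchIn (suc k) (suc m) = cong suc (punchOut-punchIn k m)

punchIn-punchOut : ∀ {k x} → x ≢ k → punchIn k (punchOut k x) ≡ x
punchIn-punchOut {zero}  {zero}  0≢0 = ⊥-elim (0≢0 refl)
punchIn-punchOut {zero}  {suc x} _   = refl
punchIn-punchOut {suc k} {zero}  _   = refl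
punchIn-punchOut {suc k} {suc x} x≢k = cong suc (punchIn-punchOut (λ eq → x≢k (cong suc eq)))

punchIn-injective : ∀ k → Injective _≡_ _≡_ (punchIn k)
punchIn-injective k {m} {n} eq =
  ≡.trans (≡.sym (punchOut-punchIn k m)) (≡.trans (cong (punchOut k) eq) (punchOut-punchIn k n))

punchIn-≢ : ∀ k m → punchIn k m ≢ k
punchIn-≢ zero    m       ()
punchIn-≢ (suc k) zero    ()
punchIn-≢ (suc k) (suc m) eq = punchIn-≢ k m (suc-injective eq)

insert𝟎 : ℕ → Env → Env
insert𝟎 zero    Γ = Γ ,₀ 𝟎
insert𝟎 (suc k) Γ = insert𝟎 k (Γ ∘ suc) ,₀ Γ zero

delete : ℕ → Env → Env
delete k Γ n = Γ (punchIn k n)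

insert𝟎-cong : ∀ k {Γ Δ} → Γ ≈ᴱ Δ → insert𝟎 k Γ ≈ᴱ insert𝟎 k Δ
insert𝟎-cong zero    e = ,₀-cong e ≈-refl
insert𝟎-cong (suc k) e = ,₀-cong (insert𝟎-cong k (e ∘ suc)) (e zero)

insert𝟎-⊎ : ∀ k Γ Δ → insert𝟎 k (Γ ⊎ᴱ Δ) ≈ᴱ (insert𝟎 k Γ ⊎ᴱ insert𝟎 k Δ)
insert𝟎-⊎ zero    Γ Δ = ≈ᴱ-sym (,₀-⊎ Γ Δ 𝟎 𝟎)
insert𝟎-⊎ (suc k) Γ Δ =
  ≈ᴱ-trans (,₀-cong (insert𝟎-⊎ k _ _) ≈-refl) (≈ᴱ-sym (,₀-⊎ _ _ (Γ zero) (Δ zero)))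

insert𝟎-𝟎 : ∀ k → insert𝟎 k 𝟎ᴱ ≈ᴱ 𝟎ᴱ
insert𝟎-𝟎 zero    = ,₀-𝟎
insert𝟎-𝟎 (suc k) = ≈ᴱ-trans (,₀-cong (insert𝟎-𝟎 k) ≈-refl) ,₀-𝟎

insert𝟎-[∶] : ∀ k x P → insert𝟎 k [ x ∶ P ] ≈ᴱ [ punchIn k x ∶ P ]
insert𝟎-[∶] zero    x       P zero    = ≈-refl
insert𝟎-[∶] zero    x       P (suc n) = ≡⇒≈ (≡.sym ([∶]-inj suc-injective x n))
insert𝟎-[∶] (suc k) zero    P zero    = ≈-refl
insert𝟎-[∶] (suc k) (suc x) P zero    = ≈-refl
insert𝟎-[∶] (suc k) zero    P (suc n) = insert𝟎-𝟎 k n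
insert𝟎-[∶] (suc k) (suc x) P (suc n) =
  ≈-trans (insert𝟎-cong k (λ m → ≡⇒≈ ([∶]-inj suc-injective x m)) n)
          (≈-trans (insert𝟎-[∶] k x P n) (≡⇒≈ (≡.sym ([∶]-inj suc-injective (punchIn k x) n))))

delete-[∶]-≢ : ∀ {k x} P → x ≢ k → delete k [ x ∶ P ] ≈ᴱ [ punchOut k x ∶ P ]
delete-[∶]-≢ {k} {x} P x≢k with punchOut k x | punchIn-punchOut {k} {x} x≢k
... | y | refl = λ m → ≡⇒≈ ([∶]-inj (punchIn-injective k) y m)

delete-[∶]-≡ : ∀ k P → delete k [ k ∶ P ] ≈ᴱ 𝟎ᴱ
delete-[∶]-≡ k P m = ≡⇒≈ ([∶]-≢ (punchIn-≢ k m))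

mutual
  size : ∀ {Γ t Q} → Γ ⊢ t ∶ Q → ℕ
  size (ax _ _)      = 0
  size (lam ds _ _)  = sizeλ ds
  size (app d e _ _) = suc (size d + size e)

  sizeλ : ∀ {Γ t L} → Γ ⊢λ t ∶ L → ℕ
  sizeλ []       = 0
  sizeλ (d ∷ ds) = size d + sizeλ ds

⊢-resp-≈ : ∀ {Γ Γ' t Q Q'} → Γ ≈ᴱ Γ' → Q ≈ Q' → Γ ⊢ t ∶ Q → Γ' ⊢ t ∶ Q'
⊢-resp-≈ g q (ax e r)       = ax (≈ᴱ-trans (≈ᴱ-sym g) e) (≈-trans (≈-sym q) r)
⊢-resp-≈ g q (lam ds e r)   = lam ds (≈ᴱ-trans (≈ᴱ-sym g) e) (≈-trans (≈-sym q) r)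
⊢-resp-≈ g q (app d d' e r) = app d d' (≈ᴱ-trans (≈ᴱ-sym g) e) (≈-trans (≈-sym q) r)

size-⊢-resp-≈ : ∀ {Γ Γ' t Q Q'} (g : Γ ≈ᴱ Γ') (q : Q ≈ Q') (d : Γ ⊢ t ∶ Q) →
                size (⊢-resp-≈ g q d) ≡ size d
size-⊢-resp-≈ g q (ax _ _)    = refl
size-⊢-resp-≈ g q (lam _ _ _) = refl
size-⊢-resp-≈ g q (app _ _ _ _) = refl

ƛ-intro : ∀ {Γ t P Q} → (Γ ,₀ P) ⊢ t ∶ Q → Γ ⊢ ƛ t ∶ mk ((P , Q) ∷ [])
ƛ-intro {Γ} d = lam (_∷_ {Γ = Γ} d []) (≈ᴱ-sym (⊎ᴱ-identityʳ Γ)) ≈-refl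

size-ƛ-intro : ∀ {Γ t P Q} (d : (Γ ,₀ P) ⊢ t ∶ Q) → size (ƛ-intro d) ≡ size d
size-ƛ-intro d = +-identityʳ (size d)

ƛ-inv : ∀ {Γ t P Q} (d : Γ ⊢ ƛ t ∶ mk ((P , Q) ∷ [])) →
        Σ[ d' ∈ (Γ ,₀ P) ⊢ t ∶ Q ] size d' ≡ size d
ƛ-inv (lam ds e (mk r)) with ≈ᴸ-[-] (≈ᴸ-sym r)
ƛ-inv {Γ} {P = P} (lam (_∷_ {Γ = Γ₁} {P = A} d []) e (mk r)) | _ , _ , refl , p , q =
  ⊢-resp-≈ g q d , ≡.trans (size-⊢-resp-≈ g q d) (≡.sym (+-identityʳ _))
  where
  g : (Γ₁ ,₀ A) ≈ᴱ (Γ ,₀ P)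
  g = ,₀-cong (≈ᴱ-sym (≈ᴱ-trans e (⊎ᴱ-identityʳ Γ₁))) p

⊢λ-perm : ∀ {Δ t L L'} (ds : Δ ⊢λ t ∶ L) → L ≈ᴸ L' →
          Σ[ Δ' ∈ Env ] Δ ≈ᴱ Δ' × Σ[ ds' ∈ Δ' ⊢λ t ∶ L' ] sizeλ ds' ≡ sizeλ ds
⊢λ-perm [] [] = _ , ≈ᴱ-refl , [] , refl
⊢λ-perm (_∷_ {Γ = Γ} d ds) ((p , q) ∷ e) with ⊢λ-perm ds e
... | Δ' , g , ds' , s =
  Γ ⊎ᴱ Δ' , ⊎ᴱ-cong (≈ᴱ-refl {Γ}) g , ⊢-resp-≈ (,₀-cong ≈ᴱ-refl p) q d ∷ ds' ,
  cong₂ _+_ (size-⊢-resp-≈ (,₀-cong ≈ᴱ-refl p) q d) s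
⊢λ-perm (_∷_ {Γ = Γ₁} d₁ (_∷_ {Γ = Γ₂} {Δ = Δ} d₂ ds)) swap =
  Γ₂ ⊎ᴱ (Γ₁ ⊎ᴱ Δ) , ⊎ᴱ-swapˡ Γ₁ Γ₂ Δ , d₂ ∷ (d₁ ∷ ds) , +-swap (size d₂) (size d₁) (sizeλ ds)
  where
  +-swap : ∀ a b c → a + (b + c) ≡ b + (a + c)
  +-swap = solve-∀
⊢λ-perm ds (trans e f) with ⊢λ-perm ds e
... | Δ₁ , g₁ , ds₁ , s₁ with ⊢λ-perm ds₁ f
... | Δ₂ , g₂ , ds₂ , s₂ = Δ₂ , ≈ᴱ-trans g₁ g₂ , ds₂ , ≡.trans s₂ s₁

⊢λ-++⁻ : ∀ {Δ t} L₁ {L₂} (ds : Δ ⊢λ t ∶ (L₁ ++ L₂)) →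
  Σ[ Δ₁ ∈ Env ] Σ[ Δ₂ ∈ Env ] Σ[ ds₁ ∈ Δ₁ ⊢λ t ∶ L₁ ] Σ[ ds₂ ∈ Δ₂ ⊢λ t ∶ L₂ ]
  Δ ≈ᴱ (Δ₁ ⊎ᴱ Δ₂) × sizeλ ds₁ + sizeλ ds₂ ≡ sizeλ ds
⊢λ-++⁻ {Δ} [] ds = 𝟎ᴱ , Δ , [] , ds , ≈ᴱ-sym (⊎ᴱ-identityˡ Δ) , refl
⊢λ-++⁻ (_ ∷ L₁) (_∷_ {Γ = Γ} d ds) with ⊢λ-++⁻ L₁ ds
... | Δ₁ , Δ₂ , ds₁ , ds₂ , g , s =
  Γ ⊎ᴱ Δ₁ , Δ₂ , d ∷ ds₁ , ds₂ ,
  ≈ᴱ-trans (⊎ᴱ-cong (≈ᴱ-refl {Γ}) g) (≈ᴱ-sym (⊎ᴱ-assoc Γ Δ₁ Δ₂)) ,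
  ≡.trans (+-assoc (size d) (sizeλ ds₁) (sizeλ ds₂)) (cong (size d +_) s)

⊢λ-++⁺ : ∀ {Δ₁ Δ₂ t L₁ L₂} → Δ₁ ⊢λ t ∶ L₁ → Δ₂ ⊢λ t ∶ L₂ →
         Σ[ Δ ∈ Env ] Δ ≈ᴱ (Δ₁ ⊎ᴱ Δ₂) × Δ ⊢λ t ∶ (L₁ ++ L₂)
⊢λ-++⁺ {Δ₂ = Δ₂} [] ds₂ = Δ₂ , ≈ᴱ-sym (⊎ᴱ-identityˡ Δ₂) , ds₂
⊢λ-++⁺ {Δ₂ = Δ₂} (_∷_ {Γ = Γ} {Δ = Δ} d ds) ds₂ with ⊢λ-++⁺ ds ds₂
... | Δ' , g , ds' = Γ ⊎ᴱ Δ' , ≈ᴱ-trans (⊎ᴱ-cong (≈ᴱ-refl {Γ}) g) (≈ᴱ-sym (⊎ᴱ-assoc Γ Δ Δ₂)) , d ∷ ds'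

value-𝟎 : ∀ {w} → Value w → 𝟎ᴱ ⊢ w ∶ 𝟎
value-𝟎 (var n) = ax (≈ᴱ-sym ([∶𝟎] n)) ≈-refl
value-𝟎 (ƛ t)   = lam [] ≈ᴱ-refl ≈-refl

value-𝟎-env : ∀ {w Δ P} → Value w → Δ ⊢ w ∶ P → P ≈ 𝟎 → Δ ≈ᴱ 𝟎ᴱ
value-𝟎-env (var n) (ax e q) z = ≈ᴱ-trans e (≈ᴱ-trans ([∶]-cong (≈-trans (≈-sym q) z)) ([∶𝟎] n))
value-𝟎-env (ƛ t) (lam ds e r) z with ≈-trans (≈-sym r) z
... | mk r' with ≈ᴸ-[] r'
value-𝟎-env (ƛ t) (lam [] e r) z | mk r' | refl = e

value-split : ∀ {w Δ P} → Value w → (d : Δ ⊢ w ∶ P) → ∀ P₁ P₂ → P ≈ (P₁ ⊎ᴾ P₂) →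
  Σ[ Δ₁ ∈ Env ] Σ[ Δ₂ ∈ Env ] Σ[ d₁ ∈ Δ₁ ⊢ w ∶ P₁ ] Σ[ d₂ ∈ Δ₂ ⊢ w ∶ P₂ ]
  Δ ≈ᴱ (Δ₁ ⊎ᴱ Δ₂) × size d₁ + size d₂ ≤ size d
value-split (var n) (ax e q) P₁ P₂ p =
  [ n ∶ P₁ ] , [ n ∶ P₂ ] , ax ≈ᴱ-refl ≈-refl , ax ≈ᴱ-refl ≈-refl ,
  ≈ᴱ-trans e (≈ᴱ-trans ([∶]-cong (≈-trans (≈-sym q) p)) (≈ᴱ-sym ([∶]-⊎ n P₁ P₂))) , z≤n
value-split (ƛ t) (lam ds e r) (mk L₁) (mk L₂) p with ≈-trans (≈-sym r) p
... | mk r' with ⊢λ-perm ds r'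
... | Δ' , g , ds' , s with ⊢λ-++⁻ L₁ ds'
... | Δ₁ , Δ₂ , ds₁ , ds₂ , g' , s' =
  Δ₁ , Δ₂ , lam ds₁ ≈ᴱ-refl ≈-refl , lam ds₂ ≈ᴱ-refl ≈-refl ,
  ≈ᴱ-trans e (≈ᴱ-trans g g') , ≤-reflexive (≡.trans s' s)

value-merge : ∀ {w Δ₁ Δ₂ P₁ P₂} → Value w → Δ₁ ⊢ w ∶ P₁ → Δ₂ ⊢ w ∶ P₂ →
              (Δ₁ ⊎ᴱ Δ₂) ⊢ w ∶ (P₁ ⊎ᴾ P₂)
value-merge (var n) (ax {P = A} e q) (ax {P = B} e' q') =
  ax (≈ᴱ-trans (⊎ᴱ-cong e e') (≈ᴱ-trans ([∶]-⊎ n A B) ([∶]-cong (≈-sym (⊎ᴾ-cong q q'))))) ≈-refl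
value-merge (ƛ t) (lam ds e r) (lam ds' e' r') with ⊢λ-++⁺ ds ds'
... | Δ , g , ds'' = lam ds'' (≈ᴱ-trans (⊎ᴱ-cong e e') (≈ᴱ-sym g)) (⊎ᴾ-cong r r')

-- Weakening, strengthening and relevance

mutual
  weaken : ∀ k {Γ t Q} (d : Γ ⊢ t ∶ Q) →
           Σ[ d' ∈ insert𝟎 k Γ ⊢ rename (punchIn k) t ∶ Q ] size d' ≡ size d
  weaken k {t = var x} (ax {P = P} e q) =
    ax (≈ᴱ-trans (insert𝟎-cong k e) (insert𝟎-[∶] k x P)) q , refl
  weaken k (lam ds e r) with weakenλ k ds
  ... | Δ' , g , ds' , s = lam ds' (≈ᴱ-trans (insert𝟎-cong k e) (≈ᴱ-sym g)) r , s
  weaken k (app {Γ = Γ} {Δ = Δ} d₁ d₂ e r) with weaken k d₁ | weaken k d₂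
  ... | d₁' , s₁ | d₂' , s₂ =
    app d₁' d₂' (≈ᴱ-trans (insert𝟎-cong k e) (insert𝟎-⊎ k Γ Δ)) r , cong suc (cong₂ _+_ s₁ s₂)

  weakenλ : ∀ k {Δ t L} (ds : Δ ⊢λ t ∶ L) →
    Σ[ Δ' ∈ Env ] Δ' ≈ᴱ insert𝟎 k Δ ×
    Σ[ ds' ∈ Δ' ⊢λ rename (punchIn (suc k)) t ∶ L ] sizeλ ds' ≡ sizeλ ds
  weakenλ k [] = 𝟎ᴱ , ≈ᴱ-sym (insert𝟎-𝟎 k) , [] , refl
  weakenλ k (_∷_ {Γ = Γ} {Δ = Δ} {P = P} d ds) with weaken (suc k) d | weakenλ k ds
  ... | d' , s | Δ' , g , ds' , s' =
    insert𝟎 k Γ ⊎ᴱ Δ' , ≈ᴱ-trans (⊎ᴱ-cong (≈ᴱ-refl {insert𝟎 k Γ}) g) (≈ᴱ-sym (insert𝟎-⊎ k Γ Δ)) ,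
    _∷_ {Γ = insert𝟎 k Γ} {P = P} d' ds' , cong₂ _+_ s s'

ext-injective : ∀ {ρ} → Injective _≡_ _≡_ ρ → Injective _≡_ _≡_ (ext ρ)
ext-injective ρ-inj {zero}  {zero}  _  = refl
ext-injective ρ-inj {suc a} {suc b} eq = cong suc (ρ-inj (suc-injective eq))

,₀-ext : ∀ ρ Γ P → ((Γ ,₀ P) ∘ ext ρ) ≈ᴱ ((Γ ∘ ρ) ,₀ P)
,₀-ext ρ Γ P zero    = ≈-refl
,₀-ext ρ Γ P (suc n) = ≈-refl

mutual
  strengthen : ∀ {ρ} → Injective _≡_ _≡_ ρ → ∀ t {Γ Q} → Γ ⊢ rename ρ t ∶ Q → (Γ ∘ ρ) ⊢ t ∶ Q
  strengthen {ρ} ρ-inj (var x) (ax e q) = ax (λ n → ≈-trans (e (ρ n)) (≡⇒≈ ([∶]-inj ρ-inj x n))) q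
  strengthen {ρ} ρ-inj (ƛ t) (lam ds e r) = lam (strengthenλ ρ-inj t ds) (λ n → e (ρ n)) r
  strengthen {ρ} ρ-inj (t · u) (app d₁ d₂ e r) =
    app (strengthen ρ-inj t d₁) (strengthen ρ-inj u d₂) (λ n → e (ρ n)) r

  strengthenλ : ∀ {ρ} → Injective _≡_ _≡_ ρ → ∀ t {Δ L} → Δ ⊢λ rename (ext ρ) t ∶ L → (Δ ∘ ρ) ⊢λ t ∶ L
  strengthenλ ρ-inj t [] = []
  strengthenλ {ρ} ρ-inj t (_∷_ {Γ = Γ} {P = P} d ds) =
    ⊢-resp-≈ (,₀-ext ρ Γ P) ≈-refl (strengthen (ext-injective ρ-inj) t d) ∷ strengthenλ ρ-inj t ds

∈Fv-rename : ∀ {ρ n} t → n ∈Fv rename ρ t → ∃ λ m → ρ m ≡ n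
∈Fv-rename (var x) var = x , refl
∈Fv-rename (ƛ t) (ƛ n∈) with ∈Fv-rename t n∈
... | suc m , eq = m , suc-injective eq
∈Fv-rename (t · u) (appˡ n∈) = ∈Fv-rename t n∈
∈Fv-rename (t · u) (appʳ n∈) = ∈Fv-rename u n∈

mutual
  ∉Fv⇒𝟎 : ∀ {Γ t Q} → Γ ⊢ t ∶ Q → ∀ n → ¬ n ∈Fv t → Γ n ≈ 𝟎
  ∉Fv⇒𝟎 {t = var x} (ax e q) n n∉ = ≈-trans (e n) (≡⇒≈ ([∶]-≢ {x} {n} λ { refl → n∉ var }))
  ∉Fv⇒𝟎 (lam ds e r) n n∉ = ≈-trans (e n) (∉Fv⇒𝟎λ ds n (n∉ ∘ ƛ))
  ∉Fv⇒𝟎 (app d₁ d₂ e r) n n∉ =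
    ≈-trans (e n) (⊎ᴾ-cong (∉Fv⇒𝟎 d₁ n (n∉ ∘ appˡ)) (∉Fv⇒𝟎 d₂ n (n∉ ∘ appʳ)))

  ∉Fv⇒𝟎λ : ∀ {Δ t L} → Δ ⊢λ t ∶ L → ∀ n → ¬ suc n ∈Fv t → Δ n ≈ 𝟎
  ∉Fv⇒𝟎λ []       n n∉ = ≈-refl
  ∉Fv⇒𝟎λ (d ∷ ds) n n∉ = ⊎ᴾ-cong (∉Fv⇒𝟎 d (suc n) n∉) (∉Fv⇒𝟎λ ds n n∉)

unshift : ∀ {Γ t Q} → Γ ⊢ shift t ∶ Q → (Γ ∘ suc) ⊢ t ∶ Q × Γ zero ≈ 𝟎
unshift {t = t} d =
  strengthen suc-injective t d , ∉Fv⇒𝟎 d zero (λ 0∈ → 1+n≢0 (proj₂ (∈Fv-rename t 0∈)))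

SingleValueSubst : ℕ → (ℕ → Term) → Set
SingleValueSubst k σ = Value (σ k) × (∀ n → n ≢ k → σ n ≡ var (punchOut k n))

value-shift : ∀ {w} → Value w → Value (shift w)
value-shift (var n) = var (suc n)
value-shift (ƛ t)   = ƛ _

single-SingleValueSubst : ∀ {v} → Value v → SingleValueSubst zero (single v)
single-SingleValueSubst v-val = v-val , λ { zero 0≢0 → ⊥-elim (0≢0 refl) ; (suc n) _ → refl }

exts-SingleValueSubst : ∀ {k σ} → SingleValueSubst k σ → SingleValueSubst (suc k) (exts σ)
exts-SingleValueSubst (σk-val , σ-lower) =
  value-shift σk-val ,
  λ { zero _ → refl ; (suc n) n≢k → cong shift (σ-lower n (λ eq → n≢k (cong suc eq))) }

+-interchange-≤ : ∀ a b x y {a' b' z} → a' ≤ a + x → b' ≤ b + y → x + y ≤ z → a' + b' ≤ (a + b) + z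
+-interchange-≤ a b x y {a'} {b'} {z} a'≤ b'≤ xy≤z = begin
  a' + b'             ≤⟨ +-mono-≤ a'≤ b'≤ ⟩
  (a + x) + (b + y)   ≡⟨ regroup a b x y ⟩
  (a + b) + (x + y)   ≤⟨ +-monoʳ-≤ (a + b) xy≤z ⟩
  (a + b) + z         ∎
  where
  open ≤-Reasoning
  regroup : ∀ a b x y → (a + x) + (b + y) ≡ (a + b) + (x + y)
  regroup = solve-∀

sub-⊢-var : ∀ {k σ} → SingleValueSubst k σ → ∀ {Γ x Q} (d : Γ ⊢ var x ∶ Q) →
            ∀ {Δ} (dw : Δ ⊢ σ k ∶ Γ k) → Σ[ d' ∈ (delete k Γ ⊎ᴱ Δ) ⊢ σ x ∶ Q ] size d' ≤ size dw
sub-⊢-var {k} σ-single {Γ} {x} (ax {P = P} e q) {Δ} dw with x ≟ k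
... | yes refl = ⊢-resp-≈ g (≈-trans (e k) (≈-trans (≡⇒≈ ([∶]-≡ k)) (≈-sym q))) dw ,
                 ≤-reflexive (size-⊢-resp-≈ g _ dw)
  where
  g : Δ ≈ᴱ (delete k Γ ⊎ᴱ Δ)
  g = ≈ᴱ-sym (≈ᴱ-trans (⊎ᴱ-cong (λ m → ≈-trans (e _) (delete-[∶]-≡ k P m)) (≈ᴱ-refl {Δ}))
                       (⊎ᴱ-identityˡ Δ))
... | no x≢k rewrite proj₂ σ-single x x≢k = ax g q , z≤n
  where
  Δ≈𝟎 : Δ ≈ᴱ 𝟎ᴱ
  Δ≈𝟎 = value-𝟎-env (proj₁ σ-single) dw (≈-trans (e k) (≡⇒≈ ([∶]-≢ (x≢k ∘ ≡.sym))))
  g : (delete k Γ ⊎ᴱ Δ) ≈ᴱ [ punchOut k x ∶ P ]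
  g = ≈ᴱ-trans (⊎ᴱ-cong (λ m → ≈-trans (e _) (delete-[∶]-≢ P x≢k m)) Δ≈𝟎) (⊎ᴱ-identityʳ _)

mutual
  sub-⊢ : ∀ {k σ} → SingleValueSubst k σ → ∀ {Γ t Q} (d : Γ ⊢ t ∶ Q) → ∀ {Δ} (dw : Δ ⊢ σ k ∶ Γ k) →
          Σ[ d' ∈ (delete k Γ ⊎ᴱ Δ) ⊢ sub σ t ∶ Q ] size d' ≤ size d + size dw
  sub-⊢ σ-single d@(ax _ _) dw = sub-⊢-var σ-single d dw
  sub-⊢ {k} σ-single (lam ds e r) {Δ} dw with sub-⊢λ σ-single ds (⊢-resp-≈ ≈ᴱ-refl (e k) dw)
  ... | Θ , g , ds' , s =
    lam ds' (≈ᴱ-trans (⊎ᴱ-cong (e ∘ punchIn k) (≈ᴱ-refl {Δ})) (≈ᴱ-sym g)) r ,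
    ≡.subst (λ z → sizeλ ds' ≤ sizeλ ds + z) (size-⊢-resp-≈ ≈ᴱ-refl (e k) dw) s
  sub-⊢ {k} σ-single (app {Γ = Γ₁} {Δ = Γ₂} d₁ d₂ e r) dw
    with value-split (proj₁ σ-single) dw (Γ₁ k) (Γ₂ k) (e k)
  ... | Δ₁ , Δ₂ , dw₁ , dw₂ , g , s with sub-⊢ σ-single d₁ dw₁ | sub-⊢ σ-single d₂ dw₂
  ... | d₁' , s₁ | d₂' , s₂ =
    app d₁' d₂'
        (≈ᴱ-trans (⊎ᴱ-cong (e ∘ punchIn k) g) (⊎ᴱ-interchange (delete k Γ₁) (delete k Γ₂) Δ₁ Δ₂)) r ,
    s≤s (+-interchange-≤ (size d₁) (size d₂) (size dw₁) (size dw₂) s₁ s₂ s)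

  sub-⊢λ : ∀ {k σ} → SingleValueSubst k σ → ∀ {Γ t L} (ds : Γ ⊢λ t ∶ L) → ∀ {Δ} (dw : Δ ⊢ σ k ∶ Γ k) →
    Σ[ Θ ∈ Env ] Θ ≈ᴱ (delete k Γ ⊎ᴱ Δ) ×
    Σ[ ds' ∈ Θ ⊢λ sub (exts σ) t ∶ L ] sizeλ ds' ≤ sizeλ ds + size dw
  sub-⊢λ {k} σ-single [] {Δ} dw =
    𝟎ᴱ ,
    ≈ᴱ-sym (≈ᴱ-trans (⊎ᴱ-cong (≈ᴱ-refl {𝟎ᴱ}) (value-𝟎-env (proj₁ σ-single) dw ≈-refl)) (⊎ᴱ-identityʳ 𝟎ᴱ)) ,
    [] , z≤n
  sub-⊢λ {k} {σ} σ-single (_∷_ {Γ = Γ₁} {Δ = Δ₁} {t = t} {P = P} {Q = Q} d ds) dw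
    with value-split (proj₁ σ-single) dw (Γ₁ k) (Δ₁ k) ≈-refl
  ... | Δa , Δb , dw₁ , dw₂ , g , s with weaken zero dw₁
  ... | dw₁' , s' with sub-⊢ (exts-SingleValueSubst σ-single) d dw₁' | sub-⊢λ σ-single ds dw₂
  ... | d' , s₁ | Θ , g₂ , ds' , s₂ =
    (delete k Γ₁ ⊎ᴱ Δa) ⊎ᴱ Θ ,
    ≈ᴱ-trans (⊎ᴱ-cong (≈ᴱ-refl {delete k Γ₁ ⊎ᴱ Δa}) g₂)
      (≈ᴱ-trans (⊎ᴱ-interchange (delete k Γ₁) Δa (delete k Δ₁) Δb) (⊎ᴱ-cong ≈ᴱ-refl (≈ᴱ-sym g))) ,
    _∷_ {Γ = delete k Γ₁ ⊎ᴱ Δa} {P = P} d'' ds' ,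
    +-interchange-≤ (size d) (sizeλ ds) (size dw₁) (size dw₂) size-d'' s₂ s
    where
    body-env : (delete (suc k) (Γ₁ ,₀ P) ⊎ᴱ (Δa ,₀ 𝟎)) ≈ᴱ ((delete k Γ₁ ⊎ᴱ Δa) ,₀ P)
    body-env zero    = ⊎ᴾ-identityʳ P
    body-env (suc m) = ≈-refl
    d'' : ((delete k Γ₁ ⊎ᴱ Δa) ,₀ P) ⊢ sub (exts σ) t ∶ Q
    d'' = ⊢-resp-≈ body-env ≈-refl d'
    size-d'' : size d'' ≤ size d + size dw₁
    size-d'' = begin
      size d''          ≡⟨ size-⊢-resp-≈ body-env ≈-refl d' ⟩
      size d'           ≤⟨ s₁ ⟩
      size d + size dw₁' ≡⟨ cong (size d +_) s' ⟩
      size d + size dw₁ ∎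
      where open ≤-Reasoning

sub-⊢⁻-var : ∀ {k σ} → SingleValueSubst k σ → ∀ x {Γ Q} → Γ ⊢ σ x ∶ Q →
  Σ[ Θ ∈ Env ] Σ[ Δ ∈ Env ] Θ ⊢ var x ∶ Q × Δ ⊢ σ k ∶ Θ k × Γ ≈ᴱ (delete k Θ ⊎ᴱ Δ)
sub-⊢⁻-var {k} σ-single x {Γ} {Q} d with x ≟ k
... | yes refl =
  [ k ∶ Q ] , Γ , ax ≈ᴱ-refl ≈-refl , ⊢-resp-≈ ≈ᴱ-refl (≡⇒≈ (≡.sym ([∶]-≡ k))) d ,
  ≈ᴱ-sym (≈ᴱ-trans (⊎ᴱ-cong (delete-[∶]-≡ k Q) (≈ᴱ-refl {Γ})) (⊎ᴱ-identityˡ Γ))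
... | no x≢k with ≡.subst (λ u → Γ ⊢ u ∶ Q) (proj₂ σ-single x x≢k) d
... | ax e q =
  [ x ∶ Q ] , 𝟎ᴱ , ax ≈ᴱ-refl ≈-refl ,
  ⊢-resp-≈ ≈ᴱ-refl (≡⇒≈ (≡.sym ([∶]-≢ (x≢k ∘ ≡.sym)))) (value-𝟎 (proj₁ σ-single)) ,
  ≈ᴱ-trans e (≈ᴱ-trans ([∶]-cong (≈-sym q))
    (≈ᴱ-trans (≈ᴱ-sym (delete-[∶]-≢ Q x≢k)) (≈ᴱ-sym (⊎ᴱ-identityʳ _))))

mutual
  sub-⊢⁻ : ∀ {k σ} → SingleValueSubst k σ → ∀ t {Γ Q} → Γ ⊢ sub σ t ∶ Q →
    Σ[ Θ ∈ Env ] Σ[ Δ ∈ Env ] Θ ⊢ t ∶ Q × Δ ⊢ σ k ∶ Θ k × Γ ≈ᴱ (delete k Θ ⊎ᴱ Δ)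
  sub-⊢⁻ σ-single (var x) d = sub-⊢⁻-var σ-single x d
  sub-⊢⁻ σ-single (ƛ t) (lam ds e r) with sub-⊢⁻λ σ-single t ds
  ... | Θ , Δ , ds' , dw , g = Θ , Δ , lam ds' ≈ᴱ-refl r , dw , ≈ᴱ-trans e g
  sub-⊢⁻ {k} σ-single (t · u) (app d₁ d₂ e r)
    with sub-⊢⁻ σ-single t d₁ | sub-⊢⁻ σ-single u d₂
  ... | Θ₁ , Δ₁ , d₁' , dw₁ , g₁ | Θ₂ , Δ₂ , d₂' , dw₂ , g₂ =
    Θ₁ ⊎ᴱ Θ₂ , Δ₁ ⊎ᴱ Δ₂ , app d₁' d₂' ≈ᴱ-refl r , value-merge (proj₁ σ-single) dw₁ dw₂ ,
    ≈ᴱ-trans e (≈ᴱ-trans (⊎ᴱ-cong g₁ g₂) (⊎ᴱ-interchange (delete k Θ₁) Δ₁ (delete k Θ₂) Δ₂))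

  sub-⊢⁻λ : ∀ {k σ} → SingleValueSubst k σ → ∀ t {Γ L} → Γ ⊢λ sub (exts σ) t ∶ L →
    Σ[ Θ ∈ Env ] Σ[ Δ ∈ Env ] Θ ⊢λ t ∶ L × Δ ⊢ σ k ∶ Θ k × Γ ≈ᴱ (delete k Θ ⊎ᴱ Δ)
  sub-⊢⁻λ σ-single t [] = 𝟎ᴱ , 𝟎ᴱ , [] , value-𝟎 (proj₁ σ-single) , λ m → ≈-refl
  sub-⊢⁻λ {k} σ-single t (_∷_ {P = P} d ds)
    with sub-⊢⁻ (exts-SingleValueSubst σ-single) t d | sub-⊢⁻λ σ-single t ds
  ... | Θ₁ , Δa , d' , dw' , g | Θ₂ , Δb , ds' , dw₂ , g₂ with unshift dw'
  ... | dw₁ , Δa0≈𝟎 =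
    (Θ₁ ∘ suc) ⊎ᴱ Θ₂ , (Δa ∘ suc) ⊎ᴱ Δb ,
    _∷_ {Γ = Θ₁ ∘ suc} {P = P} (⊢-resp-≈ Θ₁≈ ≈-refl d') ds' , value-merge (proj₁ σ-single) dw₁ dw₂ ,
    ≈ᴱ-trans (⊎ᴱ-cong (g ∘ suc) g₂) (⊎ᴱ-interchange _ _ (delete k Θ₂) Δb)
    where
    Θ₁≈ : Θ₁ ≈ᴱ ((Θ₁ ∘ suc) ,₀ P)
    Θ₁≈ zero    = ≈-sym (≈-trans (g zero) (≈-trans (⊎ᴾ-cong (≈-refl {Θ₁ zero}) Δa0≈𝟎) (⊎ᴾ-identityʳ _)))
    Θ₁≈ (suc n) = ≈-refl

-- Subject reduction and expansion

⊢-βv : ∀ {Θ t v R} → Value v → (d : Θ ⊢ ƛ t · v ∶ R) → Σ[ d' ∈ Θ ⊢ t [ v ] ∶ R ] size d' < size d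
⊢-βv {v = v} v-val (app d₁ d₂ e r) with ƛ-inv d₁
... | dt , s with sub-⊢ (single-SingleValueSubst v-val) dt d₂
... | d' , s' = ⊢-resp-≈ (≈ᴱ-sym e) (≈-sym r) d' , s≤s (begin
  size (⊢-resp-≈ (≈ᴱ-sym e) (≈-sym r) d') ≡⟨ size-⊢-resp-≈ (≈ᴱ-sym e) (≈-sym r) d' ⟩
  size d'                                 ≤⟨ s' ⟩
  size dt + size d₂                       ≡⟨ cong (_+ size d₂) s ⟩
  size d₁ + size d₂                       ∎)
  where open ≤-Reasoning

⊢-σ₁ : ∀ {Θ t u s R} (d : Θ ⊢ (ƛ t · u) · s ∶ R) →
       Σ[ d' ∈ Θ ⊢ ƛ (t · shift s) · u ∶ R ] size d' ≡ size d
⊢-σ₁ {Θ} {t} {s = s} d@(app {Δ = Δ₀} {P = P} {Q = Q} (app {Γ = Γ₁} {Δ = Δ₁} {P = P'} d₁ du e₁ r₁) ds e r)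
  with ƛ-inv d₁ | weaken zero ds
... | dt , size-dt | ds' , size-ds' = app (ƛ-intro body) du env r , size-eq
  where
  dt' : (Γ₁ ,₀ P') ⊢ t ∶ mk ((P , Q) ∷ [])
  dt' = ⊢-resp-≈ ≈ᴱ-refl (≈-sym r₁) dt
  body-env : ((Γ₁ ⊎ᴱ Δ₀) ,₀ P') ≈ᴱ ((Γ₁ ,₀ P') ⊎ᴱ (Δ₀ ,₀ 𝟎))
  body-env zero    = ≈-sym (⊎ᴾ-identityʳ P')
  body-env (suc n) = ≈-refl
  body : ((Γ₁ ⊎ᴱ Δ₀) ,₀ P') ⊢ t · shift s ∶ Q
  body = app dt' ds' body-env ≈-refl
  env : Θ ≈ᴱ ((Γ₁ ⊎ᴱ Δ₀) ⊎ᴱ Δ₁)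
  env = ≈ᴱ-trans e (≈ᴱ-trans (⊎ᴱ-cong e₁ (≈ᴱ-refl {Δ₀})) (⊎ᴱ-swapʳ Γ₁ Δ₁ Δ₀))
  size-eq : size (app (ƛ-intro body) du env r) ≡ size d
  size-eq = begin
    suc (size (ƛ-intro body) + size du)
      ≡⟨ cong (λ n → suc (n + size du)) (size-ƛ-intro body) ⟩
    suc (suc (size dt' + size ds') + size du)
      ≡⟨ cong₂ (λ a b → suc (suc (a + b) + size du))
               (≡.trans (size-⊢-resp-≈ ≈ᴱ-refl _ dt) size-dt) size-ds' ⟩
    suc (suc (size d₁ + size ds) + size du)
      ≡⟨ regroup (size d₁) (size du) (size ds) ⟩
    suc (suc (size d₁ + size du) + size ds) ∎
    where
    open ≡-Reasoning
    regroup : ∀ a b c → suc (suc (a + c) + b) ≡ suc (suc (a + b) + c)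
    regroup = solve-∀

⊢-σ₃ : ∀ {Θ v s u R} (d : Θ ⊢ v · (ƛ s · u) ∶ R) →
       Σ[ d' ∈ Θ ⊢ ƛ (shift v · s) · u ∶ R ] size d' ≡ size d
⊢-σ₃ {Θ} {v} {s} d@(app {Γ = Γ} {P = P} {Q = Q} dv (app {Γ = Δ₁} {Δ = Δ₂} {P = P'} {Q = Q'} dl du e₁ r₁) e r)
  with ƛ-inv dl | weaken zero dv
... | ds , size-ds | dv' , size-dv' = app (ƛ-intro body) du env r , size-eq
  where
  ds' : (Δ₁ ,₀ P') ⊢ s ∶ P
  ds' = ⊢-resp-≈ ≈ᴱ-refl (≈-sym r₁) ds
  body-env : ((Γ ⊎ᴱ Δ₁) ,₀ P') ≈ᴱ ((Γ ,₀ 𝟎) ⊎ᴱ (Δ₁ ,₀ P'))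
  body-env zero    = ≈-sym (⊎ᴾ-identityˡ P')
  body-env (suc n) = ≈-refl
  body : ((Γ ⊎ᴱ Δ₁) ,₀ P') ⊢ shift v · s ∶ Q
  body = app dv' ds' body-env ≈-refl
  env : Θ ≈ᴱ ((Γ ⊎ᴱ Δ₁) ⊎ᴱ Δ₂)
  env = ≈ᴱ-trans e (≈ᴱ-trans (⊎ᴱ-cong (≈ᴱ-refl {Γ}) e₁) (≈ᴱ-sym (⊎ᴱ-assoc Γ Δ₁ Δ₂)))
  size-eq : size (app (ƛ-intro body) du env r) ≡ size d
  size-eq = begin
    suc (size (ƛ-intro body) + size du)
      ≡⟨ cong (λ n → suc (n + size du)) (size-ƛ-intro body) ⟩
    suc (suc (size dv' + size ds') + size du)
      ≡⟨ cong₂ (λ a b → suc (suc (a + b) + size du))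
               size-dv' (≡.trans (size-⊢-resp-≈ ≈ᴱ-refl _ ds) size-ds) ⟩
    suc (suc (size dv + size dl) + size du)
      ≡⟨ regroup (size dv) (size dl) (size du) ⟩
    suc (size dv + suc (size dl + size du)) ∎
    where
    open ≡-Reasoning
    regroup : ∀ a b c → suc (suc (a + b) + c) ≡ suc (a + suc (b + c))
    regroup = solve-∀

⊢-βv⁻ : ∀ {Γ t v Q} → Value v → Γ ⊢ t [ v ] ∶ Q → Γ ⊢ ƛ t · v ∶ Q
⊢-βv⁻ {t = t} v-val d with sub-⊢⁻ (single-SingleValueSubst v-val) t d
... | Θ , Δ , dt , dv , g = app (ƛ-intro (⊢-resp-≈ (,₀-η Θ) ≈-refl dt)) dv g ≈-refl

⊢-σ₁⁻ : ∀ {Θ t u s R} → Θ ⊢ ƛ (t · shift s) · u ∶ R → Θ ⊢ (ƛ t · u) · s ∶ R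
⊢-σ₁⁻ {Θ} (app {Δ = Δ} {P = P} dl du e r) with ƛ-inv dl
... | app {Γ = Γ₁} {Δ = Γ₂} dt ds' e₂ r₂ , _ with unshift ds'
... | ds , Γ₂0≈𝟎 = app (app (ƛ-intro (⊢-resp-≈ Γ₁≈ ≈-refl dt)) du ≈ᴱ-refl ≈-refl) ds env (≈-trans r r₂)
  where
  Γ₁≈ : Γ₁ ≈ᴱ ((Γ₁ ∘ suc) ,₀ P)
  Γ₁≈ zero    = ≈-sym (≈-trans (e₂ zero) (≈-trans (⊎ᴾ-cong (≈-refl {Γ₁ zero}) Γ₂0≈𝟎) (⊎ᴾ-identityʳ _)))
  Γ₁≈ (suc n) = ≈-refl
  env : Θ ≈ᴱ (((Γ₁ ∘ suc) ⊎ᴱ Δ) ⊎ᴱ (Γ₂ ∘ suc))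
  env = ≈ᴱ-trans e (≈ᴱ-trans (⊎ᴱ-cong (e₂ ∘ suc) (≈ᴱ-refl {Δ})) (⊎ᴱ-swapʳ _ _ Δ))

⊢-σ₃⁻ : ∀ {Θ v s u R} → Θ ⊢ ƛ (shift v · s) · u ∶ R → Θ ⊢ v · (ƛ s · u) ∶ R
⊢-σ₃⁻ {Θ} (app {Δ = Δ} {P = P} dl du e r) with ƛ-inv dl
... | app {Γ = Γ₁} {Δ = Γ₂} dv' ds e₂ r₂ , _ with unshift dv'
... | dv , Γ₁0≈𝟎 = app dv (app (ƛ-intro (⊢-resp-≈ Γ₂≈ ≈-refl ds)) du ≈ᴱ-refl ≈-refl) env (≈-trans r r₂)
  where
  Γ₂≈ : Γ₂ ≈ᴱ ((Γ₂ ∘ suc) ,₀ P)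
  Γ₂≈ zero    = ≈-sym (≈-trans (e₂ zero) (≈-trans (⊎ᴾ-cong Γ₁0≈𝟎 (≈-refl {Γ₂ zero})) (⊎ᴾ-identityˡ _)))
  Γ₂≈ (suc n) = ≈-refl
  env : Θ ≈ᴱ ((Γ₁ ∘ suc) ⊎ᴱ ((Γ₂ ∘ suc) ⊎ᴱ Δ))
  env = ≈ᴱ-trans e (≈ᴱ-trans (⊎ᴱ-cong (e₂ ∘ suc) (≈ᴱ-refl {Δ})) (⊎ᴱ-assoc _ _ Δ))

↦-reduction : ∀ {Γ t u Q} → t ↦shuf u → Γ ⊢ t ∶ Q → Γ ⊢ u ∶ Q
↦-reduction (βv v-val) d = proj₁ (⊢-βv v-val d)
↦-reduction σ₁         d = proj₁ (⊢-σ₁ d)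
↦-reduction (σ₃ _)     d = proj₁ (⊢-σ₃ d)

↦-expansion : ∀ {Γ t u Q} → t ↦shuf u → Γ ⊢ u ∶ Q → Γ ⊢ t ∶ Q
↦-expansion (βv v-val) d = ⊢-βv⁻ v-val d
↦-expansion σ₁         d = ⊢-σ₁⁻ d
↦-expansion (σ₃ _)     d = ⊢-σ₃⁻ d

mutual
  subject-reduction : ∀ {Γ t u Q} → t →shuf u → Γ ⊢ t ∶ Q → Γ ⊢ u ∶ Q
  subject-reduction (root r) d                = ↦-reduction r d
  subject-reduction (lam st) (lam ds e r)     = lam (subject-reductionλ st ds) e r
  subject-reduction (appˡ st) (app d₁ d₂ e r) = app (subject-reduction st d₁) d₂ e r
  subject-reduction (appʳ st) (app d₁ d₂ e r) = app d₁ (subject-reduction st d₂) e r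

  subject-reductionλ : ∀ {Δ t u L} → t →shuf u → Δ ⊢λ t ∶ L → Δ ⊢λ u ∶ L
  subject-reductionλ st []       = []
  subject-reductionλ st (d ∷ ds) = subject-reduction st d ∷ subject-reductionλ st ds

mutual
  subject-expansion : ∀ {Γ t u Q} → t →shuf u → Γ ⊢ u ∶ Q → Γ ⊢ t ∶ Q
  subject-expansion (root r) d                = ↦-expansion r d
  subject-expansion (lam st) (lam ds e r)     = lam (subject-expansionλ st ds) e r
  subject-expansion (appˡ st) (app d₁ d₂ e r) = app (subject-expansion st d₁) d₂ e r
  subject-expansion (appʳ st) (app d₁ d₂ e r) = app d₁ (subject-expansion st d₂) e r

  subject-expansionλ : ∀ {Δ t u L} → t →shuf u → Δ ⊢λ u ∶ L → Δ ⊢λ t ∶ L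
  subject-expansionλ st []       = []
  subject-expansionλ st (d ∷ ds) = subject-expansion st d ∷ subject-expansionλ st ds

-- Typable terms are strongly normalising

-- Variables weigh 2 so that all weights are at least 2; this is what makes
-- σ₁ and σ₃ strictly decrease the weight.
weight : Term → ℕ
weight (var _) = 2
weight (ƛ t)   = suc (weight t)
weight (t · u) = weight t * weight u

weight-rename : ∀ ρ t → weight (rename ρ t) ≡ weight t
weight-rename ρ (var x) = refl
weight-rename ρ (ƛ t)   = cong suc (weight-rename (ext ρ) t)
weight-rename ρ (t · u) = cong₂ _*_ (weight-rename ρ t) (weight-rename ρ u)

2≤weight : ∀ t → 2 ≤ weight t
2≤weight (var x) = ≤-refl
2≤weight (ƛ t)   = m≤n⇒m≤1+n (2≤weight t)
2≤weight (t · u) = *-mono-≤ {1} (≤-trans (s≤s z≤n) (2≤weight t)) (2≤weight u)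

weight-nonZero : ∀ t → NonZero (weight t)
weight-nonZero t = >-nonZero (≤-trans (s≤s z≤n) (2≤weight t))

weight-σ₁ : ∀ t u s → weight (ƛ (t · shift s) · u) < weight ((ƛ t · u) · s)
weight-σ₁ t u s rewrite weight-rename suc s =
  [1+ac]b<[1+a]bc (weight t) (weight u) (weight s) {{weight-nonZero u}} (2≤weight s)
  where
  [1+ac]b<[1+a]bc : ∀ a b c .{{_ : NonZero b}} → 1 < c → suc (a * c) * b < suc a * b * c
  [1+ac]b<[1+a]bc a b c 1<c = begin-strict
    suc (a * c) * b    ≡⟨ lhs a b c ⟩
    b + a * b * c      <⟨ +-monoˡ-< (a * b * c) (m<m*n b c 1<c) ⟩
    b * c + a * b * c  ≡⟨ rhs a b c ⟩
    suc a * b * c      ∎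
    where
    open ≤-Reasoning
    lhs : ∀ a b c → suc (a * c) * b ≡ b + a * b * c
    lhs = solve-∀
    rhs : ∀ a b c → b * c + a * b * c ≡ suc a * b * c
    rhs = solve-∀

weight-σ₃ : ∀ v s u → weight (ƛ (shift v · s) · u) < weight (v · (ƛ s · u))
weight-σ₃ v s u rewrite weight-rename suc v =
  [1+ab]c<a[1+b]c (weight v) (weight s) (weight u) {{weight-nonZero u}} (2≤weight v)
  where
  [1+ab]c<a[1+b]c : ∀ a b c .{{_ : NonZero c}} → 1 < a → suc (a * b) * c < a * (suc b * c)
  [1+ab]c<a[1+b]c a b c 1<a = begin-strict
    suc (a * b) * c    ≡⟨ lhs a b c ⟩
    c + a * b * c      <⟨ +-monoˡ-< (a * b * c) (m<m*n c a 1<a) ⟩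
    c * a + a * b * c  ≡⟨ rhs a b c ⟩
    a * (suc b * c)    ∎
    where
    open ≤-Reasoning
    lhs : ∀ a b c → suc (a * b) * c ≡ c + a * b * c
    lhs = solve-∀
    rhs : ∀ a b c → c * a + a * b * c ≡ a * (suc b * c)
    rhs = solve-∀

_⊏_ : ℕ × ℕ → ℕ × ℕ → Set
_⊏_ = ×-Lex _≡_ _<_ _<_

⊏-map : ∀ (f g : ℕ → ℕ) → (∀ {a b} → a < b → f a < f b) → (∀ {x y} → x < y → g x < g y) →
        ∀ {a x b y} → (a , x) ⊏ (b , y) → (f a , g x) ⊏ (f b , g y)
⊏-map f g f-mono g-mono (inj₁ a<b)          = inj₁ (f-mono a<b)
⊏-map f g f-mono g-mono (inj₂ (refl , x<y)) = inj₂ (refl , g-mono x<y)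

measure : ∀ {Γ t Q} → Γ ⊢ t ∶ Q → ℕ × ℕ
measure {t = t} d = size d , weight t

subject-reduction-⊏ : ∀ {Γ t u Q} → t ▷shuf u → (d : Γ ⊢ t ∶ Q) →
                      Σ[ d' ∈ Γ ⊢ u ∶ Q ] measure d' ⊏ measure d
subject-reduction-⊏ (root (βv v-val)) d = map₂ inj₁ (⊢-βv v-val d)
subject-reduction-⊏ {t = (ƛ t · u) · s} (root σ₁) d =
  map₂ (λ eq → inj₂ (eq , weight-σ₁ t u s)) (⊢-σ₁ d)
subject-reduction-⊏ {t = v · (ƛ s · u)} (root (σ₃ _)) d =
  map₂ (λ eq → inj₂ (eq , weight-σ₃ v s u)) (⊢-σ₃ d)
subject-reduction-⊏ {t = ƛ t · s} (lamApp st) (app d₁ d₂ e r) with ƛ-inv d₁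
... | dt , sdt with subject-reduction-⊏ st dt
... | dt' , lt =
  app (ƛ-intro dt') d₂ e r ,
  ≡.subst₂ _⊏_ (cong (λ n → suc (n + size d₂) , _) (≡.sym (size-ƛ-intro dt')))
               (cong (λ n → suc (n + size d₂) , _) sdt)
               (⊏-map (λ n → suc (n + size d₂)) (λ n → suc n * weight s)
                      (λ lt → s≤s (+-monoˡ-< (size d₂) lt))
                      (λ lt → *-monoˡ-< (weight s) {{weight-nonZero s}} (s≤s lt)) lt)
subject-reduction-⊏ {t = t · s} (appˡ st) (app d₁ d₂ e r) with subject-reduction-⊏ st d₁
... | d₁' , lt =
  app d₁' d₂ e r ,
  ⊏-map (λ n → suc (n + size d₂)) (_* weight s)
        (λ lt → s≤s (+-monoˡ-< (size d₂) lt)) (*-monoˡ-< (weight s) {{weight-nonZero s}}) lt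
subject-reduction-⊏ {t = t · s} (appʳ st) (app d₁ d₂ e r) with subject-reduction-⊏ st d₂
... | d₂' , lt =
  app d₁ d₂' e r ,
  ⊏-map (λ n → suc (size d₁ + n)) (weight t *_)
        (λ lt → s≤s (+-monoʳ-< (size d₁) lt)) (*-monoʳ-< (weight t) {{weight-nonZero t}}) lt

typable⇒SN : ∀ {Γ t Q} → Γ ⊢ t ∶ Q → ▷shuf-SN t
typable⇒SN d = acc⇒SN d (×-wellFounded <-wellFounded <-wellFounded (measure d))
  where
  acc⇒SN : ∀ {Γ t Q} (d : Γ ⊢ t ∶ Q) → Acc _⊏_ (measure d) → ▷shuf-SN t
  acc⇒SN d (acc rec) = acc λ st → let d' , lt = subject-reduction-⊏ st d in acc⇒SN d' (rec lt)

-- Normal forms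

Reducible : Term → Set
Reducible t = ∃ λ u → t ▷shuf u

RootRedex : Term → Set
RootRedex t = ∃ λ u → t ↦shuf u

rootRedex? : ∀ a b → RootRedex (a · b) ⊎ ¬ RootRedex (a · b)
rootRedex? (ƛ a)   (var y)        = inj₁ (_ , βv (var y))
rootRedex? (ƛ a)   (ƛ b)          = inj₁ (_ , βv (ƛ b))
rootRedex? (ƛ a)   (ƛ s · u)      = inj₁ (_ , σ₃ (ƛ a))
rootRedex? (ƛ a)   (var y · e)    = inj₂ λ { (_ , βv ()) }
rootRedex? (ƛ a)   ((c · c') · e) = inj₂ λ { (_ , βv ()) }
rootRedex? (var x) (ƛ s · u)      = inj₁ (_ , σ₃ (var x))
rootRedex? (var x) (var y)        = inj₂ λ { (_ , ()) }
rootRedex? (var x) (ƛ b)          = inj₂ λ { (_ , ()) }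
rootRedex? (var x) (var y · e)    = inj₂ λ { (_ , ()) }
rootRedex? (var x) ((c · c') · e) = inj₂ λ { (_ , ()) }
rootRedex? (ƛ a · u)      s       = inj₁ (_ , σ₁)
rootRedex? (var y · u)    b       = inj₂ λ { (_ , σ₃ ()) }
rootRedex? ((c · c') · u) b       = inj₂ λ { (_ , σ₃ ()) }

BodyNormal : Term → Set
BodyNormal (ƛ a) = ▷shuf-normal a
BodyNormal _     = ⊤

·-normal : ∀ {a b} → ¬ RootRedex (a · b) → ▷shuf-normal a → ▷shuf-normal b → BodyNormal a →
           ▷shuf-normal (a · b)
·-normal no-redex a-nf b-nf body-nf (_ , root r)   = no-redex (_ , r)
·-normal no-redex a-nf b-nf body-nf (_ , lamApp s) = body-nf (_ , s)
·-normal no-redex a-nf b-nf body-nf (_ , appˡ s)   = a-nf (_ , s)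
·-normal no-redex a-nf b-nf body-nf (_ , appʳ s)   = b-nf (_ , s)

reducible? : ∀ t → Reducible t ⊎ ▷shuf-normal t
reducible? (var x) = inj₂ λ { (_ , root ()) }
reducible? (ƛ t)   = inj₂ λ { (_ , root ()) }
reducible? (a · b) with rootRedex? a b | reducible? a | reducible? b
... | inj₁ (u , r) | _               | _               = inj₁ (u , root r)
... | inj₂ _       | inj₁ (a' , s)   | _               = inj₁ (a' · b , appˡ s)
... | inj₂ _       | inj₂ _          | inj₁ (b' , s)   = inj₁ (a · b' , appʳ s)
... | inj₂ nr      | inj₂ a-nf       | inj₂ b-nf with a
...   | var x  = inj₂ (·-normal nr a-nf b-nf tt)
...   | c · c' = inj₂ (·-normal nr a-nf b-nf tt)
...   | ƛ a'   with reducible? a'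
...     | inj₁ (a'' , s) = inj₁ (ƛ a'' · b , lamApp s)
...     | inj₂ a'-nf     = inj₂ (·-normal nr a-nf b-nf a'-nf)

SN⇒normalizable : ∀ {t} → ▷shuf-SN t → ▷shuf-normalizable t
SN⇒normalizable {t} (acc rec) with reducible? t
... | inj₂ t-nf = t , ε , t-nf
... | inj₁ (u , s) with SN⇒normalizable (rec s)
... | v , ss , v-nf = v , s ◅ ss , v-nf

Typable : Term → Set
Typable t = ∃₂ λ Γ Q → Γ ⊢ t ∶ Q

NotLam : Term → Set
NotLam (ƛ _) = ⊥
NotLam _     = ⊤

normal-fun : ∀ {a b} → ▷shuf-normal (a · b) → ▷shuf-normal a
normal-fun nf (_ , s) = nf (_ , appˡ s)

normal-arg : ∀ {a b} → ▷shuf-normal (a · b) → ▷shuf-normal b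
normal-arg nf (_ , s) = nf (_ , appʳ s)

normal-body : ∀ {a b} → ▷shuf-normal (ƛ a · b) → ▷shuf-normal a
normal-body nf (_ , s) = nf (_ , lamApp s)

normal-head : ∀ {c c' e} → ▷shuf-normal ((c · c') · e) → NotLam c
normal-head {ƛ _}   nf = nf (_ , root σ₁)
normal-head {var _} nf = tt
normal-head {_ · _} nf = tt

normal-argHead : ∀ {a c e} → ▷shuf-normal (ƛ a · (c · e)) → NotLam c
normal-argHead {c = ƛ _}   nf = nf (_ , root (σ₃ (ƛ _)))
normal-argHead {c = var _} nf = tt
normal-argHead {c = _ · _} nf = tt

-- A normal application whose head is not a λ can be typed at any Q: its head
-- variable receives an arrow type ending in Q.
mutual
  normal⇒typable : ∀ t → ▷shuf-normal t → Typable t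
  normal⇒typable (var x)     nf = [ x ∶ 𝟎 ] , 𝟎 , ax ≈ᴱ-refl ≈-refl
  normal⇒typable (ƛ t)       nf = 𝟎ᴱ , 𝟎 , lam [] ≈ᴱ-refl ≈-refl
  normal⇒typable (ƛ a · var y) nf = ⊥-elim (nf (_ , root (βv (var y))))
  normal⇒typable (ƛ a · ƛ b)   nf = ⊥-elim (nf (_ , root (βv (ƛ b))))
  normal⇒typable (ƛ a · (c · e)) nf with normal⇒typable a (normal-body nf)
  ... | Γ , Q , da with neutral⇒typable c e (normal-argHead nf) (normal-arg nf) (Γ zero)
  ... | Δ , de = _ , Q , app (ƛ-intro (⊢-resp-≈ (,₀-η Γ) ≈-refl da)) de ≈ᴱ-refl ≈-refl
  normal⇒typable (var x · b)    nf = _ , 𝟎 , proj₂ (neutral⇒typable (var x) b tt nf 𝟎)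
  normal⇒typable ((c · c') · b) nf = _ , 𝟎 , proj₂ (neutral⇒typable (c · c') b tt nf 𝟎)

  neutral⇒typable : ∀ c e → NotLam c → ▷shuf-normal (c · e) → ∀ Q → ∃ λ Γ → Γ ⊢ c · e ∶ Q
  neutral⇒typable (var x) e _ nf Q with normal⇒typable e (normal-arg nf)
  ... | Δ , P , de = _ , app (ax {x = x} {P = mk ((P , Q) ∷ [])} ≈ᴱ-refl ≈-refl) de ≈ᴱ-refl ≈-refl
  neutral⇒typable (c · c') e _ nf Q with normal⇒typable e (normal-arg nf)
  ... | Δ , P , de with neutral⇒typable c c' (normal-head nf) (normal-fun nf) (mk ((P , Q) ∷ []))
  ... | Γ , dc = _ , app dc de ≈ᴱ-refl ≈-refl

▷⇒→ : ∀ {t u} → t ▷shuf u → t →shuf u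
▷⇒→ (root r)   = root r
▷⇒→ (lamApp s) = appˡ (lam (▷⇒→ s))
▷⇒→ (appˡ s)   = appˡ (▷⇒→ s)
▷⇒→ (appʳ s)   = appʳ (▷⇒→ s)

▷*⇒≃ : ∀ {t u} → Star _▷shuf_ t u → t ≃shuf u
▷*⇒≃ ε        = ε
▷*⇒≃ (s ◅ ss) = fwd (▷⇒→ s) ◅ ▷*⇒≃ ss

typable-resp-≃ : ∀ {t u} → t ≃shuf u → Typable u → Typable t
typable-resp-≃ ε T = T
typable-resp-≃ (fwd s ◅ ss) T with typable-resp-≃ ss T
... | Γ , Q , d = Γ , Q , subject-expansion s d
typable-resp-≃ (bwd s ◅ ss) T with typable-resp-≃ ss T
... | Γ , Q , d = Γ , Q , subject-reduction s d

Distinct-tail : ∀ {k x} {xs : Vec ℕ k} → Distinct (x ∷ xs) → Distinct xs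
Distinct-tail dist i j eq with dist (Fin.suc i) (Fin.suc j) eq
... | refl = refl

Distinct-head : ∀ {k x} {xs : Vec ℕ k} → Distinct (x ∷ xs) → ¬ x ∈ᵥ xs
Distinct-head dist x∈ with dist Fin.zero (Fin.suc (index x∈)) (lookup-index x∈)
... | ()

envOf-∉ : ∀ {k} (xs : Vec ℕ k) Ps n → ¬ n ∈ᵥ xs → envOf xs Ps n ≈ 𝟎
envOf-∉ [] [] n n∉ = ≈-refl
envOf-∉ (x ∷ xs) (P ∷ Ps) n n∉ =
  ⊎ᴾ-cong (≡⇒≈ ([∶]-≢ (n∉ ∘ here))) (envOf-∉ xs Ps n (n∉ ∘ there))

envOf-map-∈ : ∀ {k} (xs : Vec ℕ k) Γ → Distinct xs → ∀ n → n ∈ᵥ xs → envOf xs (V.map Γ xs) n ≈ Γ n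
envOf-map-∈ (x ∷ xs) Γ dist n n∈ with n ≟ x
envOf-map-∈ (x ∷ xs) Γ dist n n∈ | yes refl =
  ≈-trans (⊎ᴾ-cong ≈-refl (envOf-∉ xs (V.map Γ xs) n (Distinct-head dist))) (⊎ᴾ-identityʳ _)
envOf-map-∈ (x ∷ xs) Γ dist n (here n≡x) | no n≢x = ⊥-elim (n≢x n≡x)
envOf-map-∈ (x ∷ xs) Γ dist n (there n∈) | no n≢x =
  ≈-trans (⊎ᴾ-identityˡ _) (envOf-map-∈ xs Γ (Distinct-tail dist) n n∈)

⊢-envOf : ∀ {k} (xs : Vec ℕ k) {t Γ Q} → Distinct xs → FvIn t xs → Γ ⊢ t ∶ Q →
          envOf xs (V.map Γ xs) ⊢ t ∶ Q
⊢-envOf xs {Γ = Γ} dist fv d = ⊢-resp-≈ Γ≈ ≈-refl d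
  where
  Γ≈ : Γ ≈ᴱ envOf xs (V.map Γ xs)
  Γ≈ n with n ∈? xs
  ... | yes n∈ = ≈-sym (envOf-map-∈ xs Γ dist n n∈)
  ... | no n∉  = ≈-trans (∉Fv⇒𝟎 d n (n∉ ∘ fv n)) (≈-sym (envOf-∉ xs (V.map Γ xs) n n∉))

normalizable⇒typable : ∀ {t} → ▷shuf-normalizable t → Typable t
normalizable⇒typable (u , t▷*u , u-nf) = typable-resp-≃ (▷*⇒≃ t▷*u) (normal⇒typable u u-nf)

typable⇒normalizable : ∀ {t} → Typable t → ▷shuf-normalizable t
typable⇒normalizable (_ , _ , d) = SN⇒normalizable (typable⇒SN d)

mainTheorem1 : (k : ℕ) (xs : Vec ℕ k) (t : Term) → Distinct xs → FvIn t xs →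
    ((▷shuf-normalizable t ⇔ (∃ λ u → (t ≃shuf u) × ▷shuf-normal u))
    × (▷shuf-normalizable t ⇔ NonEmpty (⟦ t ⟧ xs))
    × (▷shuf-normalizable t ⇔ (∃₂ λ (Ps : Vec Pos k) (Q : Pos) → envOf xs Ps ⊢ t ∶ Q))
    × (▷shuf-normalizable t ⇔ ▷shuf-SN t))
mainTheorem1 k xs t dist fv =
  mk⇔ (λ { (u , t▷*u , u-nf) → u , ▷*⇒≃ t▷*u , u-nf })
      (λ { (u , t≃u , u-nf) → typable⇒normalizable (typable-resp-≃ t≃u (normal⇒typable u u-nf)) }) ,
  mk⇔ (λ n → let Ps , Q , d = typed-in-xs n in (Ps , Q) , d)
      (λ { (_ , d) → typable⇒normalizable (_ , _ , d) }) ,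
  mk⇔ typed-in-xs (λ { (_ , _ , d) → typable⇒normalizable (_ , _ , d) }) ,
  mk⇔ (λ n → typable⇒SN (proj₂ (proj₂ (normalizable⇒typable n)))) SN⇒normalizable
  where
  typed-in-xs : ▷shuf-normalizable t → ∃₂ λ (Ps : Vec Pos k) (Q : Pos) → envOf xs Ps ⊢ t ∶ Q
  typed-in-xs n with normalizable⇒typable n
  ... | Γ , Q , d = V.map Γ xs , Q , ⊢-envOf xs dist fv d
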